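{- Let $W=(N,w,\tau)$ be a TPWN, let $S_1,S_2$ be schedulers of the MDP of $W$, and let $\sigma_1,\sigma_2$ be Mazurkiewicz-equivalent runs of $W$ such that $\sigma_1$ is compatible with $S_1$ and $\sigma_2$ is compatible with $S_2$. Then $\mathit{time}(\sigma_1)=\mathit{time}(\sigma_2)$ and $\nu_{S_1}(\sigma_1)=\nu_{S_2}(\sigma_2)$.
   Context: A workflow net is $N=(P,T,F,i,o)$: $P,T$ disjoint finite sets, $F\subseteq(P\times T)\cup(T\times P)$, $i$ without incoming and $o$ without outgoing arcs, $(P\cup T,F\cup\{(o,i)\})$ strongly connected. Pre/postsets ${}^\bullet x,x^\bullet$. Markings, firing $M\xrightarrow{t}M'$, firing sequences as usual; $\mathbf{i}$ ($\mathbf{o}$) has one token in $i$ (in $o$). A run is a firing sequence $\sigma$ with $\mathbf{i}\xrightarrow{\sigma}\mathbf{o}$. 1-safe: reachable markings have at most one token per place. Transitions $t_1,t_2$ are independent if ${}^\bullet t_1\cap{}^\bullet t_2=\emptyset$, dependent otherwise; at a 1-safe marking $M$ two enabled transitions are concurrent if independent, in conflict if dependent; $C(t,M)$ = set of transitions in conflict with $t$ at $M$ (contains $t$); $\mathcal{C}(M)=\{C(t,M):t\text{ enabled at }M\}$. Confusion-free: for every reachable $M$, enabled $t$, $u$ concurrent with $t$ at $M$: $C(u,M)=C(u,M\setminus{}^\bullet t)=C(u,(M\setminus{}^\bullet t)\cup t^\bullet)$. A TPWN is $W=(N,w,\tau)$ with $N$ 1-safe confusion-free, $w:T\to\mathbb{Q}_{>0}$,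 $\tau:T\to\mathbb{N}$. Mazurkiewicz equivalence: $\sigma\equiv_1\tau$ if $\sigma=\sigma' t_1t_2\sigma''$ and $\tau=\sigma' t_2t_1\sigma''$ for independent $t_1,t_2$; $\equiv$ is the reflexive-transitive closure of $\equiv_1$. Timing: $\mathbb{N}_\bot=\{\bot\}\cup\mathbb{N}$, $\bot\le x$, $\bot+x=\bot$; $upd(\vec x,t)_p=\max_{q\in{}^\bullet t}\vec x_q+\tau(t)$ if $p\in t^\bullet$, $\bot$ if $p\in{}^\bullet t\setminus t^\bullet$, $\vec x_p$ otherwise; $\mu(\epsilon)_i=0$, $\mu(\epsilon)_p=\bot$ ($p\ne i$), $\mu(\sigma t)=upd(\mu(\sigma),t)$; $\mathit{time}(\sigma)=\max_p\mu(\sigma)_p$. MDP: states are 1-safe markings $M$ and pairs $(M,t)$ with $t$ enabled at $M$, initial $\mathbf{i}$; at $M$ with no enabled transition a Dirac self-loop; otherwise one distribution per $C\in\mathcal{C}(M)$ giving $(M,t)$ probability $w(t)/\sum_{u\in C}w(u)$ for $t\in C$; from $(M,t)$ probability 1 to $M'$ with $M\xrightarrow{t}M'$. A scheduler $S$ maps each finite path to an available distribution at its last state, inducing $\mathit{Prob}^S$ on the set $\mathit{Paths}^S$ of infinite paths from $\mathbf{i}$ consistent with $S$. For $\sigma=t_1\dots t_n$ with $\mathbf{i}=M_0\xrightarrow{t_1}\cdots\xrightarrow{t_n}M_n$, $\Pi(\sigma)$ is the MDP path $M_0,(M_0,t_1),M_1,\dots,M_n$. $\nu_S(\sigma)=\mathit{Prob}^S(\mathit{cyl}^S(\Pi(\sigma)))$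 where $\mathit{cyl}^S(\pi)$ is the set of paths of $\mathit{Paths}^S$ extending $\pi$; $\sigma$ is compatible with $S$ if $\nu_S(\sigma)>0$. -}

module Defs where

open import Data.Nat as ℕ using (ℕ; zero; suc; _≤_; _⊔_; _∸_; _+_; _≡ᵇ_)
open import Data.Integer using (+_; -[1+_])
open import Data.Fin as Fin using (Fin)
open import Data.Fin.Properties using () renaming (_≟_ to _≟ᶠ_)
open import Data.Bool using (Bool; true; false; T; if_then_else_; _∧_; _∨_; not)
open import Data.Maybe using (Maybe; just; nothing)
open import Data.List using (List; []; _∷_; _++_; foldr; foldl; map; allFin)
open import Data.Bool.ListAction using (all; any)
open import Data.List.NonEmpty using (List⁺; [_]; last; _⁺∷ʳ_)
open import Data.Product using (Σ; _×_; _,_)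
open import Data.Sum using (_⊎_; inj₁; inj₂)
open import Data.Empty using (⊥)
open import Data.Rational as ℚ using (ℚ; mkℚ; 0ℚ; 1ℚ; _÷_)
open import Relation.Nullary using (does)
open import Relation.Binary.PropositionalEquality using (_≡_)
open import Relation.Binary.Construct.Closure.ReflexiveTransitive using (Star)

-- The flow relation F is given by two Boolean matrices:
--   pre t p  = true  iff (p , t) ∈ F     (p ∈ •t)
--   post t p = true  iff (t , p) ∈ F     (p ∈ t•)

record Net (np nt : ℕ) : Set where
  field
    pre  : Fin nt → Fin np → Bool
    post : Fin nt → Fin np → Bool
    i o  : Fin np

module _ {np nt : ℕ} (N : Net np nt) where
  open Net N

  -- nodes and arcs of (P ∪ T , F ∪ {(o , i)})
  Node : Set
  Node = Fin np ⊎ Fin nt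

  Arc : Node → Node → Set
  Arc (inj₁ p) (inj₂ t) = T (pre t p)
  Arc (inj₂ t) (inj₁ p) = T (post t p)
  Arc (inj₁ p) (inj₁ q) = (p ≡ o) × (q ≡ i)
  Arc (inj₂ _) (inj₂ _) = ⊥

  IsWorkflowNet : Set
  IsWorkflowNet =
      (∀ t → post t i ≡ false)
    × (∀ t → pre t o ≡ false)
    × (∀ x y → Star Arc x y)

  Marking : Set
  Marking = Fin np → ℕ

  [_]ᵇ : Bool → ℕ
  [ true ]ᵇ = 1
  [ false ]ᵇ = 0

  markI markO : Marking
  markI p = if does (p ≟ᶠ i) then 1 else 0
  markO p = if does (p ≟ᶠ o) then 1 else 0

  enabledᵇ : Marking → Fin nt → Bool
  enabledᵇ M t = all (λ p → not (pre t p) ∨ (1 ℕ.≤ᵇ M p)) (allFin np)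

  Enabled : Marking → Fin nt → Set
  Enabled M t = T (enabledᵇ M t)

  fire : Marking → Fin nt → Marking
  fire M t p = (M p ∸ [ pre t p ]ᵇ) + [ post t p ]ᵇ

  fireSeq : Marking → List (Fin nt) → Marking
  fireSeq M [] = M
  fireSeq M (t ∷ σ) = fireSeq (fire M t) σ

  FiringSeq : Marking → List (Fin nt) → Set
  FiringSeq M [] = Data.Unit.⊤ where import Data.Unit
  FiringSeq M (t ∷ σ) = Enabled M t × FiringSeq (fire M t) σ

  _≗ᴹ_ : Marking → Marking → Set
  M ≗ᴹ M' = ∀ p → M p ≡ M' p

  _≐ᵇ_ : Marking → Marking → Bool
  M ≐ᵇ M' = all (λ p → M p ≡ᵇ M' p) (allFin np)

  Reachable : Marking → Set
  Reachable M = Σ (List (Fin nt)) λ σ → FiringSeq markI σ × (fireSeq markI σ ≗ᴹ M)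

  Run : List (Fin nt) → Set
  Run σ = FiringSeq markI σ × (fireSeq markI σ ≗ᴹ markO)

  OneSafe : Set
  OneSafe = ∀ M → Reachable M → ∀ p → M p ≤ 1

  Independent : Fin nt → Fin nt → Set
  Independent t u = ∀ p → (pre t p ∧ pre u p) ≡ false

  depᵇ : Fin nt → Fin nt → Bool
  depᵇ t u = any (λ p → pre t p ∧ pre u p) (allFin np)

  inCᵇ : Marking → Fin nt → Fin nt → Bool
  inCᵇ M t x = enabledᵇ M t ∧ enabledᵇ M x ∧ depᵇ t x

  remPre : Marking → Fin nt → Marking
  remPre M t p = if pre t p then 0 else M p

  addPost : Marking → Fin nt → Marking
  addPost M t p = if post t p then 1 else M p

  ConfusionFree : Set
  ConfusionFree = ∀ M → Reachable M → ∀ t u → Enabled M t → Enabled M u →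
    Independent t u →
    ∀ x → (inCᵇ M u x ≡ inCᵇ (remPre M t) u x)
        × (inCᵇ M u x ≡ inCᵇ (addPost (remPre M t) t) u x)

  data Swap : List (Fin nt) → List (Fin nt) → Set where
    swap : ∀ σ' t₁ t₂ σ'' → Independent t₁ t₂ →
           Swap (σ' ++ t₁ ∷ t₂ ∷ σ'') (σ' ++ t₂ ∷ t₁ ∷ σ'')

  MazEquiv : List (Fin nt) → List (Fin nt) → Set
  MazEquiv = Star Swap

record TPWN (np nt : ℕ) : Set where
  field
    net      : Net np nt
    workflow : IsWorkflowNet net
    oneSafe  : OneSafe net
    cfree    : ConfusionFree net
    w        : Fin nt → ℚ
    w-pos    : ∀ t → ℚ.Positive (w t)
    τ        : Fin nt → ℕ

-- Timing.  ℕ⊥ = Maybe ℕ with nothing = ⊥.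

ℕ⊥ : Set
ℕ⊥ = Maybe ℕ

max⊥ : ℕ⊥ → ℕ⊥ → ℕ⊥
max⊥ nothing y = y
max⊥ (just a) nothing = just a
max⊥ (just a) (just b) = just (a ⊔ b)

_+⊥_ : ℕ⊥ → ℕ → ℕ⊥
nothing +⊥ _ = nothing
just a +⊥ n = just (a + n)

module _ {np nt : ℕ} (W : TPWN np nt) where
  open TPWN W
  open Net net

  upd : (Fin np → ℕ⊥) → Fin nt → (Fin np → ℕ⊥)
  upd x t p =
    if post t p
      then foldr (λ q acc → if pre t q then max⊥ (x q) acc else acc) nothing (allFin np) +⊥ τ t
      else (if pre t p then nothing else x p)

  μ₀ : Fin np → ℕ⊥
  μ₀ p = if does (p ≟ᶠ i) then just 0 else nothing

  μ : List (Fin nt) → Fin np → ℕ⊥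
  μ σ = foldl upd μ₀ σ

  time : List (Fin nt) → ℕ⊥
  time σ = foldr (λ p acc → max⊥ (μ σ p) acc) nothing (allFin np)

  State : Set
  State = Marking net ⊎ (Marking net × Fin nt)

  -- available distributions: the one for a conflict set C(t , M)
  -- (represented by t), or a Dirac distribution
  data Choice : Set where
    cls   : Fin nt → Choice
    dirac : Choice

  anyEnabledᵇ : Marking net → Bool
  anyEnabledᵇ M = any (enabledᵇ net M) (allFin nt)

  Available : State → Choice → Set
  Available (inj₁ M) c =
    if anyEnabledᵇ M
      then Σ (Fin nt) (λ t → (c ≡ cls t) × Enabled net M t)
      else c ≡ dirac
  Available (inj₂ _) c = c ≡ dirac

  -- division, total (denominator 0 gives 0; never used in that case)
  div : ℚ → ℚ → ℚ
  div a (mkℚ (+ zero) _ _) = 0ℚ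
  div a q@(mkℚ (+ suc n) _ _) = a ÷ q
  div a q@(mkℚ -[1+ n ] _ _) = a ÷ q

  sumC : Marking net → Fin nt → ℚ
  sumC M t = foldr (λ u acc → (if inCᵇ net M t u then w u else 0ℚ) ℚ.+ acc) 0ℚ (allFin nt)

  step : State → Choice → State → ℚ
  step (inj₁ M) (cls t) (inj₂ (M' , u)) =
    if _≐ᵇ_ net M M' ∧ inCᵇ net M t u then div (w u) (sumC M t) else 0ℚ
  step (inj₁ M) dirac (inj₁ M') = if _≐ᵇ_ net M M' then 1ℚ else 0ℚ
  step (inj₂ (M , t)) dirac (inj₁ M') = if _≐ᵇ_ net (fire net M t) M' then 1ℚ else 0ℚ
  step _ _ _ = 0ℚ

  record Scheduler : Set where
    field
      sched : List⁺ State → Choice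
      avail : ∀ π → Available (last π) (sched π)

  -- Prob^S (cyl^S (π₀ · rest)) given that the prefix π₀ has probability 1
  pathProb : Scheduler → List⁺ State → List State → ℚ
  pathProb S π [] = 1ℚ
  pathProb S π (s ∷ rest) =
    step (last π) (Scheduler.sched S π) s ℚ.* pathProb S (π ⁺∷ʳ s) rest

  -- Π(σ) without its initial state
  Πtail : Marking net → List (Fin nt) → List State
  Πtail M [] = []
  Πtail M (t ∷ σ) = inj₂ (M , t) ∷ inj₁ (fire net M t) ∷ Πtail (fire net M t) σ

  -- ν_S(σ) = Prob^S(cyl^S(Π σ)); Π σ starts in the initial state 𝐢
  ν : Scheduler → List (Fin nt) → ℚ
  ν S σ = pathProb S [ inj₁ (markI net) ] (Πtail (markI net) σ)

  Compatible : Scheduler → List (Fin nt) → Set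
  Compatible S σ = 0ℚ ℚ.< ν S σ

module Submission where

open import Defs
open import Data.Nat using (ℕ; _≤_; _+_; _∸_; _≤ᵇ_)
open import Data.Nat.Properties using (≡⇒≡ᵇ; <⇒≢; n≤0⇒n≡0; +-cancelʳ-≤; ≤ᵇ⇒≤; ≤⇒≤ᵇ; +-identityʳ; m≤m+n; m≤n+m; ≤-trans; ≤-antisym)
open import Data.Fin using (Fin)
open import Data.Fin.Properties using () renaming (_≟_ to _≟ᶠ_)
open import Data.List using (List; []; _∷_; _++_; foldr; foldl; allFin; filter; initLast; _∷ʳ′_)
open import Data.List.NonEmpty using (List⁺; _∷_; [_]; last; _⁺∷ʳ_)
open import Data.List.Properties using (foldl-++; foldr-cong; map-cong; filter-++; filter-accept; filter-reject; ∷-injectiveˡ; ∷-injectiveʳ)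
open import Data.List.Relation.Unary.All as All using (All; []; _∷_)
open import Data.List.Relation.Unary.All.Properties using (all⁺; all⁻)
open import Data.List.Relation.Unary.Any using (satisfied)
open import Data.List.Relation.Unary.Any.Properties using (any⁺; any⁻)
open import Data.List.Membership.Propositional using (lose)
open import Data.List.Membership.Propositional.Properties using (∈-allFin)
open import Data.Bool using (true; false; T; if_then_else_; _∧_; _∨_; not)
open import Data.Bool.Properties using (T-∧; T-≡; ∧-comm)
open import Data.Bool.ListAction using (and)
open import Data.Product using (∃; ∃₂; _×_; _,_; proj₁; proj₂)
open import Data.Sum using (_⊎_; inj₁; inj₂) renaming (swap to ⊎-swap)
open import Data.Empty using (⊥; ⊥-elim)
open import Data.Unit using (tt)
open import Algebra.Bundles using (CommutativeMonoid)
import Algebra.Properties.CommutativeSemigroup as CommutativeSemigroupProperties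
open import Data.Maybe using (nothing)
open import Data.Rational as ℚ using (ℚ; 0ℚ; 1ℚ)
import Data.Rational.Properties as ℚ
open import Function using (_∘_; Equivalence)
open import Relation.Nullary using (¬_; Dec; yes; no; contradiction)
open import Relation.Nullary.Decidable using (_⊎-dec_; T?)
open import Relation.Binary.PropositionalEquality using (_≡_; _≢_; refl; sym; trans; cong; cong₂; subst; _≗_; module ≡-Reasoning)
open import Relation.Binary.Construct.Closure.ReflexiveTransitive using (ε; _◅_)

-- Every swap in a Mazurkiewicz derivation exchanges independent transitions, so equivalent
-- sequences have the same projection onto each pair of dependent transitions.  Conversely, let
-- two firing sequences from a reachable marking have equal projections.  The first transition t
-- of one then occurs in the other preceded only by transitions independent of t, and moving it to
-- the front is a chain of swaps of concurrent transitions, each of which keeps the sequence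
-- firable.  In a 1-safe net concurrent transitions touch disjoint places, so such a swap commutes
-- both the marking update and the timing update; by confusion-freeness it leaves both conflict
-- sets, hence both choice probabilities, unchanged.  So the two sequences have the same timing
-- and the same product of choice probabilities, and for a compatible scheduler ν is exactly that
-- product, whichever representative of a conflict set the scheduler uses.  (Induction on the
-- derivation itself fails, as its intermediate sequences need not be firable.)

last-⁺∷ʳ : ∀ {A : Set} (xs : List⁺ A) x → last (xs ⁺∷ʳ x) ≡ x
last-⁺∷ʳ (y ∷ [])     x = refl
last-⁺∷ʳ (y ∷ z ∷ zs) x =
  trans (last-as-foldl y (z ∷ zs ++ x ∷ [])) (foldl-++ (λ _ v → v) y (z ∷ zs) (x ∷ []))
  where
  last-as-foldl : ∀ {A : Set} (y : A) ys → last (y ∷ ys) ≡ foldl (λ _ v → v) y ys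
  last-as-foldl y ys with initLast ys
  ... | []         = refl
  ... | ys′ ∷ʳ′ y′ = sym (foldl-++ (λ _ v → v) y ys′ (y′ ∷ []))

if-nonzero : ∀ {b} {q : ℚ} → (if b then q else 0ℚ) ≢ 0ℚ → T b
if-nonzero {true}  _  = tt
if-nonzero {false} nz = nz refl

nonzero-factors₃ : ∀ {a b c : ℚ} → a ℚ.* (b ℚ.* c) ≢ 0ℚ → a ≢ 0ℚ × b ≢ 0ℚ × c ≢ 0ℚ
nonzero-factors₃ {a} {b} {c} nz =
  (λ a≡0 → nz (trans (cong (ℚ._* (b ℚ.* c)) a≡0) (ℚ.*-zeroˡ (b ℚ.* c)))) ,
  (λ b≡0 → nz (trans (cong (λ x → a ℚ.* (x ℚ.* c)) b≡0)
                     (trans (cong (a ℚ.*_) (ℚ.*-zeroˡ c)) (ℚ.*-zeroʳ a)))) ,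
  (λ c≡0 → nz (trans (cong (λ x → a ℚ.* (b ℚ.* x)) c≡0)
                     (trans (cong (a ℚ.*_) (ℚ.*-zeroʳ b)) (ℚ.*-zeroʳ a))))

T-injective : ∀ {a b} → (T a → T b) → (T b → T a) → a ≡ b
T-injective {false} {false} _ _ = refl
T-injective {false} {true}  _ f = ⊥-elim (f tt)
T-injective {true}  {false} f _ = ⊥-elim (f tt)
T-injective {true}  {true}  _ _ = refl

module _ {np nt : ℕ} (N : Net np nt) where
  open Net N

  enabled⇒marked : ∀ {M t p} → Enabled N M t → T (pre t p) → 1 ≤ M p
  enabled⇒marked {M} {t} {p} en pre-p =
    ≤ᵇ⇒≤ 1 (M p) (subst (λ b → T (not b ∨ (1 ≤ᵇ M p))) (Equivalence.to T-≡ pre-p)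
                  (All.lookup (all⁺ _ (allFin np) en) (∈-allFin p)))

  marked⇒enabled : ∀ {M t} → (∀ p → T (pre t p) → 1 ≤ M p) → Enabled N M t
  marked⇒enabled {M} {t} marked = all⁻ _ {xs = allFin np} (All.tabulate λ {p} _ → marked′ p)
    where
    marked′ : ∀ p → T (not (pre t p) ∨ (1 ≤ᵇ M p))
    marked′ p with pre t p in e
    ... | false = tt
    ... | true  = ≤⇒≤ᵇ (marked p (Equivalence.from T-≡ e))

  independent-sym : ∀ {t u} → Independent N t u → Independent N u t
  independent-sym {t} {u} ind p = trans (∧-comm (pre u p) (pre t p)) (ind p)

  independent⇒disjoint-presets : ∀ {t u p} → Independent N t u → T (pre t p) → T (pre u p) → ⊥
  independent⇒disjoint-presets {t} {u} {p} ind pre-t pre-u =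
    subst T (ind p) (Equivalence.from T-∧ (pre-t , pre-u))

  dep⇒shared-place : ∀ {t u} → T (depᵇ N t u) → ∃ λ p → T (pre t p) × T (pre u p)
  dep⇒shared-place d with p , both ← satisfied (any⁻ _ (allFin np) d) = p , Equivalence.to T-∧ both

  shared-place⇒dep : ∀ {t u p} → T (pre t p) → T (pre u p) → T (depᵇ N t u)
  shared-place⇒dep {p = p} pre-t pre-u =
    any⁺ _ (lose (∈-allFin p) (Equivalence.from T-∧ (pre-t , pre-u)))

  dep-sym : ∀ {t u} → T (depᵇ N t u) → T (depᵇ N u t)
  dep-sym d with _ , pre-t , pre-u ← dep⇒shared-place d = shared-place⇒dep pre-u pre-t

  independent⇒¬dep : ∀ {t u} → Independent N t u → ¬ T (depᵇ N t u)
  independent⇒¬dep ind d with _ , pre-t , pre-u ← dep⇒shared-place d =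
    independent⇒disjoint-presets ind pre-t pre-u

  ¬dep⇒independent : ∀ {t u} → ¬ T (depᵇ N t u) → Independent N t u
  ¬dep⇒independent {t} {u} ¬d p with pre t p ∧ pre u p in e
  ... | false = refl
  ... | true  = contradiction (any⁺ _ (lose (∈-allFin p) (Equivalence.from T-≡ e))) ¬d

  enabledᵇ-cong : ∀ {M M'} → M ≗ M' → ∀ t → enabledᵇ N M t ≡ enabledᵇ N M' t
  enabledᵇ-cong M≗M' t =
    cong and (map-cong (λ p → cong (λ m → not (pre t p) ∨ (1 ≤ᵇ m)) (M≗M' p)) (allFin np))

  inCᵇ-cong : ∀ {M M'} → M ≗ M' → ∀ t x → inCᵇ N M t x ≡ inCᵇ N M' t x
  inCᵇ-cong M≗M' t x = cong₂ (λ a b → a ∧ b ∧ depᵇ N t x) (enabledᵇ-cong M≗M' t) (enabledᵇ-cong M≗M' x)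

  fire-local : ∀ {M M' t p} → M p ≡ M' p → fire N M t p ≡ fire N M' t p
  fire-local {t = t} {p} = cong (λ m → (m ∸ [_]ᵇ N (pre t p)) + [_]ᵇ N (post t p))

  fire-cong : ∀ {M M'} → M ≗ M' → ∀ t → fire N M t ≗ fire N M' t
  fire-cong {M} {M'} M≗M' t p = fire-local {M} {M'} (M≗M' p)

  firingSeq-resp : ∀ {M M'} → M ≗ M' → ∀ σ → FiringSeq N M σ → FiringSeq N M' σ
  firingSeq-resp M≗M' []      _           = tt
  firingSeq-resp M≗M' (t ∷ σ) (en , fseq) =
    subst T (enabledᵇ-cong M≗M' t) en , firingSeq-resp (fire-cong M≗M' t) σ fseq

  fireSeq-++ : ∀ M ρ σ → fireSeq N M (ρ ++ σ) ≡ fireSeq N (fireSeq N M ρ) σ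
  fireSeq-++ M []      σ = refl
  fireSeq-++ M (t ∷ ρ) σ = fireSeq-++ (fire N M t) ρ σ

  firingSeq-++ : ∀ M ρ σ → FiringSeq N M ρ → FiringSeq N (fireSeq N M ρ) σ → FiringSeq N M (ρ ++ σ)
  firingSeq-++ M []      σ _           fσ = fσ
  firingSeq-++ M (t ∷ ρ) σ (en , fρ)   fσ = en , firingSeq-++ (fire N M t) ρ σ fρ fσ

  reachable-markI : Reachable N (markI N)
  reachable-markI = [] , tt , λ _ → refl

  reachable-fire : ∀ {M t} → Reachable N M → Enabled N M t → Reachable N (fire N M t)
  reachable-fire {M} {t} (ρ , fρ , ρ↦M) en =
    ρ ++ t ∷ [] ,
    firingSeq-++ (markI N) ρ (t ∷ []) fρ (subst T (sym (enabledᵇ-cong ρ↦M t)) en , tt) ,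
    λ p → trans (cong (λ M' → M' p) (fireSeq-++ (markI N) ρ (t ∷ []))) (fire-cong ρ↦M t p)

  Untouched : Fin nt → Fin np → Set
  Untouched t p = (pre t p ≡ false) × (post t p ≡ false)

  fire-untouched : ∀ {M t p} → Untouched t p → fire N M t p ≡ M p
  fire-untouched {M} {p = p} (no-pre , no-post) rewrite no-pre | no-post = +-identityʳ (M p)

  Disjoint : Fin nt → Fin nt → Set
  Disjoint t u = ∀ p → Untouched t p ⊎ Untouched u p

  disjoint-sym : ∀ {t u} → Disjoint t u → Disjoint u t
  disjoint-sym disj p = ⊎-swap (disj p)

  disjoint⇒preset-untouched : ∀ {t u q} → Disjoint t u → T (pre u q) → Untouched t q
  disjoint⇒preset-untouched {q = q} disj pre-u with disj q
  ... | inj₁ t-untouched  = t-untouched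
  ... | inj₂ (no-pre , _) = ⊥-elim (subst T no-pre pre-u)

  fire-comm-untouched : ∀ {M t u p} → Untouched t p → fire N (fire N M t) u p ≡ fire N (fire N M u) t p
  fire-comm-untouched {M} {t} {u} un =
    trans (fire-local {fire N M t} {M} {u} (fire-untouched {M} un)) (sym (fire-untouched {fire N M u} un))

  fire-comm : ∀ {M t u} → Disjoint t u → fire N (fire N M t) u ≗ fire N (fire N M u) t
  fire-comm {M} disj p with disj p
  ... | inj₁ t-untouched = fire-comm-untouched {M} t-untouched
  ... | inj₂ u-untouched = sym (fire-comm-untouched {M} u-untouched)

  fire-output : ∀ {M t p} → post t p ≡ true → 1 ≤ fire N M t p
  fire-output {M} {t} {p} out rewrite out = m≤n+m 1 (M p ∸ [_]ᵇ N (pre t p))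

  enabled-fire-independent : ∀ {M t u} → Independent N u t → Enabled N M t → Enabled N (fire N M u) t
  enabled-fire-independent {M} {t} {u} ind en = marked⇒enabled marked
    where
    marked : ∀ p → T (pre t p) → 1 ≤ fire N M u p
    marked p pre-t with pre u p in e
    ... | true  = ⊥-elim (independent⇒disjoint-presets ind (Equivalence.from T-≡ e) pre-t)
    ... | false = ≤-trans (enabled⇒marked {M} en pre-t) (m≤m+n (M p) ([_]ᵇ N (post u p)))

  conflict⇒ : ∀ {M t u} → T (inCᵇ N M t u) → Enabled N M t × Enabled N M u × T (depᵇ N t u)
  conflict⇒ c with en-t , rest ← Equivalence.to T-∧ c = en-t , Equivalence.to T-∧ rest

  ⇒conflict : ∀ {M t u} → Enabled N M t → Enabled N M u → T (depᵇ N t u) → T (inCᵇ N M t u)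
  ⇒conflict en-t en-u d = Equivalence.from T-∧ (en-t , Equivalence.from T-∧ (en-u , d))

  conflict-sym : ∀ {M t u} → T (inCᵇ N M t u) → T (inCᵇ N M u t)
  conflict-sym {M} c with en-t , en-u , d ← conflict⇒ {M} c = ⇒conflict {M} en-u en-t (dep-sym d)

  remPre-disables : ∀ {M t x} → T (depᵇ N t x) → ¬ Enabled N (remPre N M x) t
  remPre-disables {M} {t} {x} d en with p , pre-t , pre-x ← dep⇒shared-place d =
    <⇒≢ (enabled⇒marked {remPre N M x} en pre-t)
        (sym (cong (λ b → if b then 0 else M p) (Equivalence.to T-≡ pre-x)))

  -- The reflexive dependency relation of trace theory: a transition with empty preset is
  -- independent of itself, hence the disjunct a ≡ b.
  Dependent : Fin nt → Fin nt → Set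
  Dependent a b = a ≡ b ⊎ T (depᵇ N a b)

  member? : (a b x : Fin nt) → Dec (x ≡ a ⊎ x ≡ b)
  member? a b x = (x ≟ᶠ a) ⊎-dec (x ≟ᶠ b)

  project : Fin nt → Fin nt → List (Fin nt) → List (Fin nt)
  project a b = filter (member? a b)

  project-keep : ∀ {a b x xs} → x ≡ a ⊎ x ≡ b → project a b (x ∷ xs) ≡ x ∷ project a b xs
  project-keep {a} {b} = filter-accept (member? a b)

  project-skip : ∀ {a b x xs} → ¬ (x ≡ a ⊎ x ≡ b) → project a b (x ∷ xs) ≡ project a b xs
  project-skip {a} {b} = filter-reject (member? a b)

  ProjEquiv : List (Fin nt) → List (Fin nt) → Set
  ProjEquiv σ₁ σ₂ = ∀ a b → Dependent a b → project a b σ₁ ≡ project a b σ₂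

  independent-members-equal : ∀ {a b x y} → Dependent a b → Independent N x y →
    (x ≡ a ⊎ x ≡ b) → (y ≡ a ⊎ y ≡ b) → x ≡ y
  independent-members-equal _ _ (inj₁ refl) (inj₁ refl) = refl
  independent-members-equal _ _ (inj₂ refl) (inj₂ refl) = refl
  independent-members-equal (inj₁ refl) _ (inj₁ refl) (inj₂ refl) = refl
  independent-members-equal (inj₁ refl) _ (inj₂ refl) (inj₁ refl) = refl
  independent-members-equal (inj₂ d) ind (inj₁ refl) (inj₂ refl) =
    contradiction d (independent⇒¬dep ind)
  independent-members-equal (inj₂ d) ind (inj₂ refl) (inj₁ refl) =
    contradiction (dep-sym d) (independent⇒¬dep ind)

  project-swap : ∀ {a b} → Dependent a b → ∀ {x y} → Independent N x y → ∀ ρ →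
    project a b (x ∷ y ∷ ρ) ≡ project a b (y ∷ x ∷ ρ)
  project-swap {a} {b} dep {x} {y} ind ρ with member? a b x | member? a b y
  ... | yes x∈ | yes y∈ rewrite independent-members-equal dep ind x∈ y∈ = refl
  ... | yes x∈ | no y∉  = begin
    project a b (x ∷ y ∷ ρ)  ≡⟨ project-keep x∈ ⟩
    x ∷ project a b (y ∷ ρ)  ≡⟨ cong (x ∷_) (project-skip y∉) ⟩
    x ∷ project a b ρ        ≡⟨ project-keep x∈ ⟨
    project a b (x ∷ ρ)      ≡⟨ project-skip y∉ ⟨
    project a b (y ∷ x ∷ ρ)  ∎
    where open ≡-Reasoning
  ... | no x∉  | yes y∈ = begin
    project a b (x ∷ y ∷ ρ)  ≡⟨ project-skip x∉ ⟩
    project a b (y ∷ ρ)      ≡⟨ project-keep y∈ ⟩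
    y ∷ project a b ρ        ≡⟨ cong (y ∷_) (project-skip x∉) ⟨
    y ∷ project a b (x ∷ ρ)  ≡⟨ project-keep y∈ ⟨
    project a b (y ∷ x ∷ ρ)  ∎
    where open ≡-Reasoning
  ... | no x∉  | no y∉  = begin
    project a b (x ∷ y ∷ ρ)  ≡⟨ project-skip x∉ ⟩
    project a b (y ∷ ρ)      ≡⟨ project-skip y∉ ⟩
    project a b ρ            ≡⟨ project-skip x∉ ⟨
    project a b (x ∷ ρ)      ≡⟨ project-skip y∉ ⟨
    project a b (y ∷ x ∷ ρ)  ∎
    where open ≡-Reasoning

  mazEquiv⇒projEquiv : ∀ {σ₁ σ₂} → MazEquiv N σ₁ σ₂ → ProjEquiv σ₁ σ₂
  mazEquiv⇒projEquiv ε _ _ _ = refl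
  mazEquiv⇒projEquiv (swap σ' t₁ t₂ σ'' ind ◅ rest) a b dep = begin
    project a b (σ' ++ t₁ ∷ t₂ ∷ σ'')              ≡⟨ filter-++ _ σ' _ ⟩
    project a b σ' ++ project a b (t₁ ∷ t₂ ∷ σ'')  ≡⟨ cong (project a b σ' ++_) (project-swap dep ind σ'') ⟩
    project a b σ' ++ project a b (t₂ ∷ t₁ ∷ σ'')  ≡⟨ filter-++ _ σ' _ ⟨
    project a b (σ' ++ t₂ ∷ t₁ ∷ σ'')              ≡⟨ mazEquiv⇒projEquiv rest a b dep ⟩
    _                                               ∎
    where open ≡-Reasoning

  project-∷-cong : ∀ {a b} u {xs ys} → project a b xs ≡ project a b ys →
    project a b (u ∷ xs) ≡ project a b (u ∷ ys)
  project-∷-cong {a} {b} u eq with member? a b u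
  ... | yes u∈ = trans (project-keep u∈)
                   (trans (cong (u ∷_) eq) (sym (project-keep u∈)))
  ... | no u∉  = trans (project-skip u∉)
                   (trans eq (sym (project-skip u∉)))

  project-∷-cancel : ∀ {a b} u {xs ys} → project a b (u ∷ xs) ≡ project a b (u ∷ ys) →
    project a b xs ≡ project a b ys
  project-∷-cancel {a} {b} u eq with member? a b u
  ... | yes u∈ = ∷-injectiveʳ (trans (sym (project-keep u∈))
                                 (trans eq (project-keep u∈)))
  ... | no u∉  = trans (sym (project-skip u∉))
                   (trans eq (project-skip u∉))

  project-move-to-front : ∀ {a b t} → Dependent a b → ∀ α β → All (Independent N t) α →
    project a b (α ++ t ∷ β) ≡ project a b (t ∷ α ++ β)
  project-move-to-front dep []      β []           = refl
  project-move-to-front dep (u ∷ α) β (t⊥u ∷ t⊥α) =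
    trans (project-∷-cong u (project-move-to-front dep α β t⊥α))
          (project-swap dep (independent-sym t⊥u) (α ++ β))

  Leads : Fin nt → List (Fin nt) → Set
  Leads t γ = ∀ u → Dependent t u → ∃ λ ys → project t u γ ≡ t ∷ ys

  leads-projEquiv : ∀ {t σ γ} → ProjEquiv (t ∷ σ) γ → Leads t γ
  leads-projEquiv {t} {σ} eq u dep =
    project t u σ , trans (sym (eq t u dep)) (project-keep (inj₁ refl))

  leads-∷ : ∀ {t y γ} → y ≢ t → ¬ T (depᵇ N t y) → Leads t (y ∷ γ) → Leads t γ
  leads-∷ {t} {y} y≢t ¬t-y leads u dep with ys , eq ← leads u dep =
    ys , trans (sym (project-skip (y∉ dep))) eq
    where
    y∉ : Dependent t u → ¬ (y ≡ t ⊎ y ≡ u)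
    y∉ _           (inj₁ y≡t)  = y≢t y≡t
    y∉ (inj₁ t≡y)  (inj₂ refl) = y≢t (sym t≡y)
    y∉ (inj₂ t-y)  (inj₂ refl) = ¬t-y t-y

  first-occurrence : ∀ t γ → Leads t γ → ∃₂ λ α β → γ ≡ α ++ t ∷ β × All (Independent N t) α
  first-occurrence t [] leads with () ← proj₂ (leads t (inj₁ refl))
  first-occurrence t (y ∷ γ) leads with t ≟ᶠ y
  ... | yes refl = [] , γ , refl , []
  ... | no t≢y with T? (depᵇ N t y)
  ...   | yes t-y = contradiction
            (∷-injectiveˡ (trans (sym (project-keep (inj₂ refl))) (proj₂ (leads y (inj₂ t-y)))))
            (t≢y ∘ sym)
  ...   | no ¬t-y with α , β , refl , t⊥α ← first-occurrence t γ (leads-∷ (t≢y ∘ sym) ¬t-y leads) =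
            y ∷ α , β , refl , ¬dep⇒independent ¬t-y ∷ t⊥α

module _ {np nt : ℕ} (N : Net np nt) (safe : OneSafe N) where
  open Net N

  output-unmarked : ∀ {M t p} → Reachable N M → Enabled N M t →
    pre t p ≡ false → post t p ≡ true → M p ≡ 0
  output-unmarked {M} {t} {p} reach en no-pre out =
    n≤0⇒n≡0 (+-cancelʳ-≤ 1 (M p) 0 fired-safe)
    where
    fired-safe : M p + 1 ≤ 1
    fired-safe = subst (_≤ 1) (cong₂ (λ a b → (M p ∸ [_]ᵇ N a) + [_]ᵇ N b) no-pre out)
                   (safe _ (reachable-fire N reach en) p)

  -- Independence excludes a common input place; an output place of one that the other touches
  -- would carry two tokens after firing both.
  concurrent⇒disjoint : ∀ {M t u} → Reachable N M → Enabled N M t → Enabled N M u →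
    Independent N t u → Disjoint N t u
  concurrent⇒disjoint {M} {t} {u} reach en-t en-u ind p
    with pre t p in a | post t p in b | pre u p in c | post u p in d
  ... | false | false | _     | _     = inj₁ (refl , refl)
  ... | _     | _     | false | false = inj₂ (refl , refl)
  ... | true  | _     | true  | _     =
    ⊥-elim (independent⇒disjoint-presets N ind (Equivalence.from T-≡ a) (Equivalence.from T-≡ c))
  ... | false | true  | true  | _     =
    ⊥-elim (<⇒≢ (enabled⇒marked N {M} en-u (Equivalence.from T-≡ c))
                (sym (output-unmarked reach en-t a b)))
  ... | true  | _     | false | true  =
    ⊥-elim (<⇒≢ (enabled⇒marked N {M} en-t (Equivalence.from T-≡ a))
                (sym (output-unmarked reach en-u c d)))
  ... | false | true  | false | true  =
    ⊥-elim (<⇒≢ (fire-output N {M} b)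
        (sym (output-unmarked (reachable-fire N reach en-t)
                              (enabled-fire-independent N ind en-u) c d)))

  enabled⇒single-token : ∀ {M u p} → Reachable N M → Enabled N M u → pre u p ≡ true → M p ≡ 1
  enabled⇒single-token {M} {p = p} reach en pre-u =
    ≤-antisym (safe _ reach p) (enabled⇒marked N {M} en (Equivalence.from T-≡ pre-u))

  addPost-remPre≗fire : ∀ {M u} → Reachable N M → Enabled N M u →
    addPost N (remPre N M u) u ≗ fire N M u
  addPost-remPre≗fire {M} {u} reach en p with pre u p in a | post u p in b
  ... | true  | true  rewrite enabled⇒single-token reach en a = refl
  ... | true  | false rewrite enabled⇒single-token reach en a = refl
  ... | false | true  rewrite output-unmarked reach en a b = refl
  ... | false | false = sym (+-identityʳ (M p))

  firingSeq-move-to-front : ∀ {M t} → Reachable N M → Enabled N M t → ∀ α β →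
    All (Independent N t) α → FiringSeq N M (α ++ t ∷ β) → FiringSeq N (fire N M t) (α ++ β)
  firingSeq-move-to-front reach en-t []      β []          (_ , fβ)    = fβ
  firingSeq-move-to-front {M} {t} reach en-t (u ∷ α) β (t⊥u ∷ t⊥α) (en-u , fs) =
    enabled-fire-independent N t⊥u en-u ,
    firingSeq-resp N (fire-comm N {M} (concurrent⇒disjoint reach en-u en-t (independent-sym N t⊥u)))
      (α ++ β)
      (firingSeq-move-to-front (reachable-fire N reach en-u)
         (enabled-fire-independent N (independent-sym N t⊥u) en-t) α β t⊥α fs)

  record TraceCongruence (R : Marking N → List (Fin nt) → List (Fin nt) → Set) : Set where
    field
      reflexive       : ∀ {M σ} → R M σ σ
      transitive      : ∀ {M σ₁ σ₂ σ₃} → R M σ₁ σ₂ → R M σ₂ σ₃ → R M σ₁ σ₃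
      prepend         : ∀ {M t σ σ'} → R (fire N M t) σ σ' → R M (t ∷ σ) (t ∷ σ')
      swap-concurrent : ∀ {M t u} ρ → Reachable N M → Enabled N M t → Enabled N M u →
                        Independent N t u → R M (t ∷ u ∷ ρ) (u ∷ t ∷ ρ)

  module _ {R} (R-cong : TraceCongruence R) where
    private module R = TraceCongruence R-cong

    related-move-to-front : ∀ {M t} → Reachable N M → Enabled N M t → ∀ α β →
      All (Independent N t) α → FiringSeq N M (α ++ t ∷ β) → R M (t ∷ α ++ β) (α ++ t ∷ β)
    related-move-to-front reach en-t []      β []          _           = R.reflexive
    related-move-to-front reach en-t (u ∷ α) β (t⊥u ∷ t⊥α) (en-u , fs) =
      R.transitive (R.swap-concurrent (α ++ β) reach en-t en-u t⊥u)
                   (R.prepend (related-move-to-front (reachable-fire N reach en-u)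
                                 (enabled-fire-independent N (independent-sym N t⊥u) en-t) α β t⊥α fs))

    projEquiv⇒related : ∀ {M} σ₁ σ₂ → Reachable N M → FiringSeq N M σ₁ → FiringSeq N M σ₂ →
      ProjEquiv N σ₁ σ₂ → R M σ₁ σ₂
    projEquiv⇒related []       []       _     _          _   _  = R.reflexive
    projEquiv⇒related []       (u ∷ σ₂) _     _          _   eq
      with () ← trans (eq u u (inj₁ refl)) (project-keep N {u} {u} {u} {σ₂} (inj₁ refl))
    projEquiv⇒related (t ∷ σ₁) σ₂       reach (en-t , fσ₁) fσ₂ eq
      with α , β , refl , t⊥α ← first-occurrence N t σ₂ (leads-projEquiv N {γ = σ₂} eq) =
      R.transitive (R.prepend (projEquiv⇒related σ₁ (α ++ β) (reachable-fire N reach en-t) fσ₁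
                                 (firingSeq-move-to-front reach en-t α β t⊥α fσ₂) tail-equiv))
                   (related-move-to-front reach en-t α β t⊥α fσ₂)
      where
      tail-equiv : ProjEquiv N σ₁ (α ++ β)
      tail-equiv a b dep =
        project-∷-cancel N t (trans (eq a b dep) (project-move-to-front N dep α β t⊥α))

module _ {np nt : ℕ} (N : Net np nt) (cfree : ConfusionFree N) where
  open Net N

  conflict-dependence : ∀ {M t u x} → Reachable N M → T (inCᵇ N M t u) → Enabled N M x →
    T (depᵇ N t x) → T (depᵇ N u x)
  conflict-dependence {M} {t} {u} {x} reach c en-x t-x with T? (depᵇ N u x)
  ... | yes u-x = u-x
  ... | no ¬u-x =
    ⊥-elim (remPre-disables N t-x (proj₁ (proj₂ (conflict⇒ N {remPre N M x} still-in-conflict))))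
    where
    still-in-conflict : T (inCᵇ N (remPre N M x) u t)
    still-in-conflict = subst T (proj₁ (cfree M reach x u en-x (proj₁ (proj₂ (conflict⇒ N {M} c)))
                                          (¬dep⇒independent N (¬u-x ∘ dep-sym N)) t))
                              (conflict-sym N {M} c)

  conflict-classes-agree : ∀ {M t u} → Reachable N M → T (inCᵇ N M t u) →
    ∀ x → inCᵇ N M t x ≡ inCᵇ N M u x
  conflict-classes-agree {M} {t} {u} reach c x = T-injective (switch c) (switch (conflict-sym N {M} c))
    where
    switch : ∀ {t u} → T (inCᵇ N M t u) → T (inCᵇ N M t x) → T (inCᵇ N M u x)
    switch c c-x with _ , en-u , _ ← conflict⇒ N {M} c | _ , en-x , t-x ← conflict⇒ N {M} c-x =
      ⇒conflict N {M} en-u en-x (conflict-dependence reach c en-x t-x)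

module _ {np nt : ℕ} (W : TPWN np nt) where
  open TPWN W
  open Net net

  sumC-cong : ∀ {M M' t t'} → (∀ x → inCᵇ net M t x ≡ inCᵇ net M' t' x) → sumC W M t ≡ sumC W M' t'
  sumC-cong same-class =
    foldr-cong (λ x acc → cong (λ b → (if b then w x else 0ℚ) ℚ.+ acc) (same-class x)) refl (allFin nt)

  sumC-fire-concurrent : ∀ {M t u} → Reachable net M → Enabled net M t → Enabled net M u →
    Independent net u t → sumC W (fire net M u) t ≡ sumC W M t
  sumC-fire-concurrent {M} {t} {u} reach en-t en-u u⊥t = sym (sumC-cong {M} {fire net M u} λ x →
    trans (proj₂ (cfree M reach u t en-u en-t u⊥t x))
          (inCᵇ-cong net (addPost-remPre≗fire net oneSafe reach en-u) t x))

  upd-local : ∀ {x y : Fin np → ℕ⊥} {u p} → (∀ q → T (pre u q) → y q ≡ x q) → y p ≡ x p →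
    upd W y u p ≡ upd W x u p
  upd-local {x} {y} {u} {p} agree-pre agree-p =
    cong₂ (λ m v → if post u p then m +⊥ τ u else (if pre u p then nothing else v))
      (foldr-cong agree-max refl (allFin np)) agree-p
    where
    agree-max : ∀ q acc →
      (if pre u q then max⊥ (y q) acc else acc) ≡ (if pre u q then max⊥ (x q) acc else acc)
    agree-max q acc with pre u q in e
    ... | true  = cong (λ v → max⊥ v acc) (agree-pre q (Equivalence.from T-≡ e))
    ... | false = refl

  upd-untouched : ∀ {x t p} → Untouched net t p → upd W x t p ≡ x p
  upd-untouched (no-pre , no-post) rewrite no-pre | no-post = refl

  upd-comm-untouched : ∀ {x t u p} → Disjoint net t u → Untouched net t p →
    upd W (upd W x t) u p ≡ upd W (upd W x u) t p
  upd-comm-untouched {x} {t} {u} disj un =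
    trans (upd-local (λ q pre-u → upd-untouched (disjoint⇒preset-untouched net disj pre-u))
                     (upd-untouched un))
          (sym (upd-untouched un))

  upd-comm : ∀ {t u} → Disjoint net t u → ∀ x → upd W (upd W x t) u ≗ upd W (upd W x u) t
  upd-comm disj x p with disj p
  ... | inj₁ t-untouched = upd-comm-untouched disj t-untouched
  ... | inj₂ u-untouched = sym (upd-comm-untouched (disjoint-sym net disj) u-untouched)

  foldl-upd-cong : ∀ {x y} → x ≗ y → ∀ ρ → foldl (upd W) x ρ ≗ foldl (upd W) y ρ
  foldl-upd-cong x≗y []      = x≗y
  foldl-upd-cong x≗y (t ∷ ρ) = foldl-upd-cong (λ p → upd-local (λ q _ → x≗y q) (x≗y p)) ρ

  SameTiming : Marking net → List (Fin nt) → List (Fin nt) → Set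
  SameTiming _ σ σ' = ∀ x → foldl (upd W) x σ ≗ foldl (upd W) x σ'

  sameTiming-congruence : TraceCongruence net oneSafe SameTiming
  sameTiming-congruence = record
    { reflexive       = λ _ _ → refl
    ; transitive      = λ s₁ s₂ x p → trans (s₁ x p) (s₂ x p)
    ; prepend         = λ {_} {t} s x → s (upd W x t)
    ; swap-concurrent = λ {M} ρ reach en-t en-u ind x →
        foldl-upd-cong (upd-comm (concurrent⇒disjoint net oneSafe {M} reach en-t en-u ind) x) ρ
    }

  time-cong : ∀ {σ₁ σ₂} → μ W σ₁ ≗ μ W σ₂ → time W σ₁ ≡ time W σ₂
  time-cong same = foldr-cong (λ p acc → cong (λ v → max⊥ v acc) (same p)) refl (allFin np)

  choiceProb : Marking net → Fin nt → ℚ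
  choiceProb M t = div W (w t) (sumC W M t)

  choiceProduct : Marking net → List (Fin nt) → ℚ
  choiceProduct M []      = 1ℚ
  choiceProduct M (t ∷ σ) = choiceProb M t ℚ.* choiceProduct (fire net M t) σ

  choiceProduct-cong : ∀ {M M'} → M ≗ M' → ∀ σ → choiceProduct M σ ≡ choiceProduct M' σ
  choiceProduct-cong M≗M' []      = refl
  choiceProduct-cong {M} {M'} M≗M' (t ∷ σ) =
    cong₂ ℚ._*_ (cong (div W (w t)) (sumC-cong {M} {M'} (inCᵇ-cong net M≗M' t)))
                (choiceProduct-cong (fire-cong net M≗M' t) σ)

  choiceProb-fire-concurrent : ∀ {M t u} → Reachable net M → Enabled net M t → Enabled net M u →
    Independent net u t → choiceProb (fire net M u) t ≡ choiceProb M t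
  choiceProb-fire-concurrent {t = t} reach en-t en-u u⊥t =
    cong (div W (w t)) (sumC-fire-concurrent reach en-t en-u u⊥t)

  choiceProduct-swap : ∀ {M t u} ρ → Reachable net M → Enabled net M t → Enabled net M u →
    Independent net t u → choiceProduct M (t ∷ u ∷ ρ) ≡ choiceProduct M (u ∷ t ∷ ρ)
  choiceProduct-swap {M} {t} {u} ρ reach en-t en-u t⊥u = begin
    choiceProb M t ℚ.* (choiceProb (fire net M t) u ℚ.* choiceProduct (fire net (fire net M t) u) ρ)
      ≡⟨ cong₂ (λ a b → choiceProb M t ℚ.* (a ℚ.* b))
               (choiceProb-fire-concurrent reach en-u en-t t⊥u)
               (choiceProduct-cong (fire-comm net {M} (concurrent⇒disjoint net oneSafe reach en-t en-u t⊥u))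
                                   ρ) ⟩
    choiceProb M t ℚ.* (choiceProb M u ℚ.* choiceProduct (fire net (fire net M u) t) ρ)
      ≡⟨ x∙yz≈y∙xz (choiceProb M t) (choiceProb M u) _ ⟩
    choiceProb M u ℚ.* (choiceProb M t ℚ.* choiceProduct (fire net (fire net M u) t) ρ)
      ≡⟨ cong (λ a → choiceProb M u ℚ.* (a ℚ.* choiceProduct (fire net (fire net M u) t) ρ))
              (choiceProb-fire-concurrent reach en-t en-u (independent-sym net t⊥u)) ⟨
    choiceProb M u ℚ.* (choiceProb (fire net M u) t ℚ.* choiceProduct (fire net (fire net M u) t) ρ) ∎
    where
    open ≡-Reasoning
    open CommutativeSemigroupProperties (CommutativeMonoid.commutativeSemigroup ℚ.*-1-commutativeMonoid)

  choiceProduct-congruence :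
    TraceCongruence net oneSafe (λ M σ σ' → choiceProduct M σ ≡ choiceProduct M σ')
  choiceProduct-congruence = record
    { reflexive       = refl
    ; transitive      = trans
    ; prepend         = λ {M} {t} → cong (choiceProb M t ℚ.*_)
    ; swap-concurrent = choiceProduct-swap
    }

  ≐ᵇ-refl : ∀ M → T (_≐ᵇ_ net M M)
  ≐ᵇ-refl M = all⁻ _ {xs = allFin np} (All.tabulate λ {p} _ → ≡⇒≡ᵇ (M p) (M p) refl)

  -- The scheduler may resolve the conflict through any t' ∈ C(t, M); all give the same class.
  step-choose : ∀ {M t} c → Reachable net M → step W (inj₁ M) c (inj₂ (M , t)) ≢ 0ℚ →
    Enabled net M t × step W (inj₁ M) c (inj₂ (M , t)) ≡ choiceProb M t
  step-choose dirac     _     nz = ⊥-elim (nz refl)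
  step-choose {M} {t} (cls t') reach nz
    with _ , c ← Equivalence.to (T-∧ {_≐ᵇ_ net M M}) (if-nonzero nz) =
    proj₁ (proj₂ (conflict⇒ net {M} c)) ,
    trans (cong (λ b → if b then div W (w t) (sumC W M t') else 0ℚ)
                (Equivalence.to T-≡ (if-nonzero {_≐ᵇ_ net M M ∧ inCᵇ net M t' t} nz)))
          (cong (div W (w t)) (sumC-cong {M} {M} (conflict-classes-agree net cfree reach c)))

  step-fire : ∀ {M t} c → step W (inj₂ (M , t)) c (inj₁ (fire net M t)) ≢ 0ℚ →
    step W (inj₂ (M , t)) c (inj₁ (fire net M t)) ≡ 1ℚ
  step-fire {M} {t} dirac _  =
    cong (λ b → if b then 1ℚ else 0ℚ) (Equivalence.to T-≡ (≐ᵇ-refl (fire net M t)))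
  step-fire (cls _)       nz = ⊥-elim (nz refl)

  pathProb-Π : ∀ (S : Scheduler W) π {M} σ → last π ≡ inj₁ M → Reachable net M →
    pathProb W S π (Πtail W M σ) ≢ 0ℚ → pathProb W S π (Πtail W M σ) ≡ choiceProduct M σ
  pathProb-Π S π []          _      _     _  = refl
  pathProb-Π S π {M} (t ∷ σ) last-π reach nz = begin
    step W (last π) c₀ s₁ ℚ.* (step W (last π₁) c₁ s₂ ℚ.* rest)  ≡⟨ at-states ⟩
    step W (inj₁ M) c₀ s₁ ℚ.* (step W s₁ c₁ s₂ ℚ.* rest)          ≡⟨ cong₂ (λ a b → a ℚ.* (b ℚ.* rest))
                                                                            (proj₂ chosen) (step-fire c₁ nz-fire) ⟩
    choiceProb M t ℚ.* (1ℚ ℚ.* rest)                              ≡⟨ cong (choiceProb M t ℚ.*_)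
                                                                            (trans (ℚ.*-identityˡ rest) continued) ⟩
    choiceProb M t ℚ.* choiceProduct M' σ                         ∎
    where
    open ≡-Reasoning
    M' = fire net M t
    s₁ = inj₂ (M , t)
    s₂ = inj₁ M'
    c₀ = Scheduler.sched S π
    π₁ = π ⁺∷ʳ s₁
    c₁ = Scheduler.sched S π₁
    π₂ = π₁ ⁺∷ʳ s₂
    rest = pathProb W S π₂ (Πtail W M' σ)
    at-states : step W (last π) c₀ s₁ ℚ.* (step W (last π₁) c₁ s₂ ℚ.* rest)
              ≡ step W (inj₁ M) c₀ s₁ ℚ.* (step W s₁ c₁ s₂ ℚ.* rest)
    at-states = cong₂ (λ s s′ → step W s c₀ s₁ ℚ.* (step W s′ c₁ s₂ ℚ.* rest)) last-π (last-⁺∷ʳ π s₁)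
    factors = nonzero-factors₃ {step W (inj₁ M) c₀ s₁} {step W s₁ c₁ s₂} (nz ∘ trans at-states)
    chosen    = step-choose c₀ reach (proj₁ factors)
    nz-fire   = proj₁ (proj₂ factors)
    continued = pathProb-Π S π₂ σ (last-⁺∷ʳ π₁ s₂) (reachable-fire net reach (proj₁ chosen))
                           (proj₂ (proj₂ factors))

  ν≡choiceProduct : ∀ (S : Scheduler W) σ → Compatible W S σ → ν W S σ ≡ choiceProduct (markI net) σ
  ν≡choiceProduct S σ compatible =
    pathProb-Π S [ inj₁ (markI net) ] σ refl (reachable-markI net)
               (λ ν≡0 → ℚ.<-irrefl (sym ν≡0) compatible)

lemma5 : ∀ {np nt : ℕ} (W : TPWN np nt) (S₁ S₂ : Scheduler W)
           (σ₁ σ₂ : List (Fin nt)) →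
           Run (TPWN.net W) σ₁ → Run (TPWN.net W) σ₂ →
           MazEquiv (TPWN.net W) σ₁ σ₂ →
           Compatible W S₁ σ₁ → Compatible W S₂ σ₂ →
           (time W σ₁ ≡ time W σ₂) × (ν W S₁ σ₁ ≡ ν W S₂ σ₂)
lemma5 W S₁ S₂ σ₁ σ₂ (fσ₁ , _) (fσ₂ , _) σ₁≡σ₂ compatible₁ compatible₂ =
  time-cong W {σ₁} {σ₂} (related (sameTiming-congruence W) (μ₀ W)) ,
  (begin
    ν W S₁ σ₁                       ≡⟨ ν≡choiceProduct W S₁ σ₁ compatible₁ ⟩
    choiceProduct W (markI net) σ₁  ≡⟨ related (choiceProduct-congruence W) ⟩
    choiceProduct W (markI net) σ₂  ≡⟨ ν≡choiceProduct W S₂ σ₂ compatible₂ ⟨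
    ν W S₂ σ₂                       ∎)
  where
  open TPWN W using (net; oneSafe)
  open ≡-Reasoning
  related : ∀ {R} → TraceCongruence net oneSafe R → R (markI net) σ₁ σ₂
  related R-cong = projEquiv⇒related net oneSafe R-cong σ₁ σ₂ (reachable-markI net) fσ₁ fσ₂
                     (mazEquiv⇒projEquiv net σ₁≡σ₂)
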